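{- A finite congruence-uniform lattice $\mathcal{L}=(L,\leq)$ satisfies $\mathrm{bdef}(\mathcal{L})=0$ if and only if $\mathcal{L}$ is distributive, where $\mathrm{bdef}(\mathcal{L})=\sum_{x\in L}\lvert\Psi(x)\setminus\Gamma(x)\rvert$.
   Context: A finite lattice is congruence uniform if it can be obtained from the one-element lattice by a finite sequence of interval doublings, where the doubling of a poset $\mathcal{P}=(P,\leq)$ by $X\subseteq P$ is the subposet of $\mathcal{P}\times\{0<1\}$ on $(P_{\leq X}\times\{0\})\uplus(((P\setminus P_{\leq X})\cup X)\times\{1\})$ with $P_{\leq X}=\{y\mid y\le x\text{ for some }x\in X\}$. An element $j$ is join-irreducible if $j=x\vee y$ implies $j\in\{x,y\}$; it has a unique lower cover $j_*$. Cover relations $x\lessdot y$ and $u\lessdot v$ are perspective if either ($v\vee x=y$ and $v\wedge x=u$) or ($u\vee y=v$ and $u\wedge y=x$). For each cover relation $x\lessdot y$ in a finite congruence-uniform lattice there is a unique join-irreducible $j$ with $(x,y)$ and $(j_*,j)$ perspective; write $\gamma(x,y)=j$. The nucleus of $x$ is $x_\downarrow=\bigwedge_{y\lessdot x}y$ (with $x_\downarrow=x$ if $x$ has no lower cover), and $\Psi(x)=\{\gamma(u,v)\mid x_\downarrow\le u\lessdot v\le x\}$. $\Gamma(x)$ is the canonical join representation of $x$: the set $X$ with $\bigvee X=x$ such that for every $Y$ with $\bigvee Y=x$, every element of $X$ lies below some element of $Y$ (it exists in finite congruence-uniform lattices). -}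

module Defs where

open import Data.Nat using (ℕ)
open import Data.Bool using (Bool; true; false; T; not; if_then_else_)
import Data.Bool as B
open import Data.Unit using (⊤)
open import Data.Product using (Σ; _×_; _,_; ∃)
open import Data.Fin using (Fin)
import Data.Fin as F
open import Data.Fin.Subset using (Subset; _∈_; _─_; ∣_∣)
open import Data.List using (List; allFin; foldr; map)
open import Data.Bool.ListAction using (any; all)
open import Data.Nat.ListAction using (sum)
open import Data.Vec using (tabulate)
open import Relation.Binary.Core using (Rel)
open import Relation.Binary.Definitions using (Decidable)
open import Relation.Binary.PropositionalEquality using (_≡_)
open import Relation.Binary.Lattice.Structures using (IsLattice)
open import Relation.Nullary.Decidable using (⌊_⌋)
open import Algebra.Core using (Op₂)
open import Algebra.Definitions using (_DistributesOverˡ_)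
open import Function.Bundles using (_↔_; Inverse)
open import Level using (0ℓ)

record Pos : Set₁ where
  field
    Carrier : Set
    _≤ᵇ_    : Carrier → Carrier → Bool

open Pos public

Iso : Pos → Pos → Set
Iso P Q = Σ (Carrier P ↔ Carrier Q) λ f →
  ∀ x y → _≤ᵇ_ P x y ≡ _≤ᵇ_ Q (Inverse.to f x) (Inverse.to f y)

OnePos : Pos
OnePos = record { Carrier = ⊤ ; _≤ᵇ_ = λ _ _ → true }

_≤₂_ : Bool → Bool → Bool
false ≤₂ _     = true
true  ≤₂ false = false
true  ≤₂ true  = true

-- Doubling of P by the interval X = [a,b] (with a ≤ b).  Then
-- P_{≤X} = {p | p ≤ b}; the carrier is
--   (P_{≤X} × {0}) ⊎ (((P ∖ P_{≤X}) ∪ X) × {1})  ⊆  P × {0<1}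
-- with the induced product order.
module _ (P : Pos) (a b : Carrier P) where
  private
    _≤_ = _≤ᵇ_ P
  inDouble : Carrier P × Bool → Bool
  inDouble (p , false) = p ≤ b
  inDouble (p , true)  = not (p ≤ b) B.∨ ((a ≤ p) B.∧ (p ≤ b))

  Double : Pos
  Double = record
    { Carrier = Σ (Carrier P × Bool) (λ q → T (inDouble q))
    ; _≤ᵇ_ = λ { ((p , i) , _) ((q , j) , _) → (p ≤ q) B.∧ (i ≤₂ j) }
    }

data CongUniform : Pos → Set₁ where
  base   : (P : Pos) → Iso P OnePos → CongUniform P
  double : (P Q : Pos) (a b : Carrier Q) → T (_≤ᵇ_ Q a b) →
           CongUniform Q → Iso P (Double Q a b) → CongUniform P

record FinLattice : Set₁ where
  field
    n         : ℕ
    _≤_       : Rel (Fin n) 0ℓ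
    _≤?_      : Decidable _≤_
    _∨_       : Op₂ (Fin n)
    _∧_       : Op₂ (Fin n)
    isLattice : IsLattice _≡_ _≤_ _∨_ _∧_

module FinLatticeDefs (L : FinLattice) where
  open FinLattice L

  toPos : Pos
  toPos = record { Carrier = Fin n ; _≤ᵇ_ = λ x y → ⌊ x ≤? y ⌋ }

  Distributive : Set
  Distributive = _DistributesOverˡ_ _≡_ _∧_ _∨_

  anyF : (Fin n → Bool) → Bool
  anyF f = any f (allFin n)

  allF : (Fin n → Bool) → Bool
  allF f = all f (allFin n)

  le eq lt : Fin n → Fin n → Bool
  le x y = ⌊ x ≤? y ⌋
  eq x y = ⌊ x F.≟ y ⌋
  lt x y = le x y B.∧ not (eq x y)

  covers : Fin n → Fin n → Bool
  covers y x = lt y x B.∧ not (anyF λ z → lt y z B.∧ lt z x)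

  -- nucleus x↓ = meet of the lower covers of x (= x if there are none);
  -- computed as x ∧ y₁ ∧ … ∧ yₖ over the lower covers yᵢ ≤ x.
  nucleus : Fin n → Fin n
  nucleus x = foldr (λ y acc → if covers y x then y ∧ acc else acc) x (allFin n)

  isBottom : Fin n → Bool
  isBottom j = allF λ z → le j z

  -- join-irreducible (the bottom element, i.e. the empty join, is excluded,
  -- so that j has a unique lower cover j_*)
  joinIrr : Fin n → Bool
  joinIrr j = not (isBottom j) B.∧
              (allF λ x → allF λ y → not (eq (x ∨ y) j) B.∨ (eq x j B.∨ eq y j))

  persp : Fin n → Fin n → Fin n → Fin n → Bool
  persp x y u v = (eq (v ∨ x) y B.∧ eq (v ∧ x) u) B.∨ (eq (u ∨ y) v B.∧ eq (u ∧ y) x)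

  gammaIs : Fin n → Fin n → Fin n → Bool
  gammaIs u v j = joinIrr j B.∧ (anyF λ c → covers c j B.∧ persp u v c j)

  Ψ : Fin n → Subset n
  Ψ x = tabulate λ j → anyF λ u → anyF λ v →
          le (nucleus x) u B.∧ covers u v B.∧ le v x B.∧ gammaIs u v j

  JoinIs : Subset n → Fin n → Set
  JoinIs X x = (∀ j → j ∈ X → j ≤ x) × (∀ z → (∀ j → j ∈ X → j ≤ z) → x ≤ z)

  IsCanonicalJoinRep : Fin n → Subset n → Set
  IsCanonicalJoinRep x X =
    JoinIs X x × (∀ Y → JoinIs Y x → ∀ j → j ∈ X → ∃ λ y → y ∈ Y × j ≤ y)

  bdef : (Fin n → Subset n) → ℕ
  bdef Γ = sum (map (λ x → ∣ Ψ x ─ Γ x ∣) (allFin n))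

-- A congruence-uniform lattice is meet-semidistributive, since the one-element
-- lattice is and interval doubling preserves meet-semidistributivity. Membership in Ψ(x) is
-- then tied to join-primality: if every join-irreducible is join-prime (as in a distributive
-- lattice), a join-irreducible j ≤ x with j ≰ x↓ cannot be omitted from the canonical join
-- representation of x, so Ψ(x) ⊆ Γ(x) and bdef = 0. Conversely, if Ψ(x) ⊆ Γ(x) for all x, a
-- well-founded induction on x, using meet-semidistributivity to trade a ∨ b for a ∨ j_* or
-- b ∨ j_*, shows that every join-irreducible is join-prime, which forces distributivity.

module Submission where

open import Defs
open import Algebra.Core using (Op₂)
open import Data.Bool using (Bool; true; false; T; not; if_then_else_)
  renaming (_∧_ to _∧ᵇ_; _∨_ to _∨ᵇ_)
open import Data.Bool.Properties using (T-∧; T-∨; T-≡)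
open import Data.Empty using (⊥-elim)
open import Data.Fin using (Fin)
import Data.Fin as F
open import Data.Fin.Induction using (po-wellFounded; po-noetherian)
open import Data.Fin.Properties using (any?; all?; ¬∀⟶∃¬)
open import Data.Fin.Subset using (Subset; _∈_; _∉_; _⊆_; _─_; ∣_∣; ⁅_⁆; _∪_; inside; outside)
open import Data.Fin.Subset.Properties using (drop-∷-⊆; x∈⁅x⁆; x∈⁅y⁆⇒x≡y; x∈p∪q⁺; x∈p∪q⁻; _∈?_)
open import Data.List using ([]; _∷_; allFin; foldr; map)
open import Data.List.Membership.Propositional using () renaming (_∈_ to _∈ₗ_)
open import Data.List.Membership.Propositional.Properties using (∈-allFin)
import Data.List.Relation.Unary.All as All
import Data.List.Relation.Unary.All.Properties as All
import Data.List.Relation.Unary.Any as Any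
import Data.List.Relation.Unary.Any.Properties as Any
open import Data.Nat using (ℕ; _+_)
open import Data.Nat.ListAction using (sum)
open import Data.Nat.Properties using (m+n≡0⇒m≡0; m+n≡0⇒n≡0)
open import Data.Product using (∃; ∃₂; _×_; _,_; proj₁; proj₂)
open import Data.Sum using (_⊎_; inj₁; inj₂; [_,_])
import Data.Sum
open import Data.Unit using (tt)
open import Data.Vec using (tabulate)
import Data.Vec as Vec
open import Data.Vec.Properties using (lookup∘tabulate; []=⇒lookup; lookup⇒[]=)
open import Function using (_∘_; flip; id; case_of_)
open import Function.Bundles using (Inverse; Equivalence; _⇔_; mk⇔)
open import Induction.WellFounded using (WellFounded; Acc; acc)
open import Level using (0ℓ)
open import Relation.Binary.Lattice using (Lattice)
import Relation.Binary.Construct.NonStrictToStrict as ToStrict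
open import Relation.Binary.PropositionalEquality
  using (_≡_; _≢_; refl; sym; trans; cong; subst; subst₂; module ≡-Reasoning)
open import Relation.Nullary using (¬_; Dec; yes; no)
open import Relation.Nullary.Decidable
  using (T?; toWitness; fromWitness; toWitnessFalse; fromWitnessFalse; decidable-stable; _×-dec_; ¬?)
import Relation.Nullary.Decidable as Dec

-- Congruence-uniform posets are meet-semidistributive lattices

≤₂-refl : ∀ i → T (i ≤₂ i)
≤₂-refl false = tt
≤₂-refl true = tt

≤₂-trans : ∀ i j k → T (i ≤₂ j) → T (j ≤₂ k) → T (i ≤₂ k)
≤₂-trans false _ _ _ _ = tt
≤₂-trans true true true _ _ = tt

→⇒≤₂ : ∀ i j → (T i → T j) → T (i ≤₂ j)
→⇒≤₂ false _ _ = tt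
→⇒≤₂ true false i⇒j = i⇒j tt
→⇒≤₂ true true _ = tt

≤₂⇒→ : ∀ i j → T (i ≤₂ j) → T i → T j
≤₂⇒→ true true _ _ = tt

≤₂-∨ˡ : ∀ i j → T (i ≤₂ (i ∨ᵇ j))
≤₂-∨ˡ false _ = tt
≤₂-∨ˡ true _ = tt

≤₂-∨ʳ : ∀ i j → T (j ≤₂ (i ∨ᵇ j))
≤₂-∨ʳ true j = →⇒≤₂ j true _
≤₂-∨ʳ false j = ≤₂-refl j

∨-≤₂ : ∀ i j k → T (i ≤₂ k) → T (j ≤₂ k) → T ((i ∨ᵇ j) ≤₂ k)
∨-≤₂ true _ _ i≤k _ = i≤k
∨-≤₂ false _ _ _ j≤k = j≤k

∧∧-≤₂ˡ : ∀ i j u → T ((i ∧ᵇ (j ∧ᵇ u)) ≤₂ i)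
∧∧-≤₂ˡ false _ _ = tt
∧∧-≤₂ˡ true j u = →⇒≤₂ (j ∧ᵇ u) true _

∧∧-≤₂ʳ : ∀ i j u → T ((i ∧ᵇ (j ∧ᵇ u)) ≤₂ j)
∧∧-≤₂ʳ false _ _ = tt
∧∧-≤₂ʳ true false _ = tt
∧∧-≤₂ʳ true true u = →⇒≤₂ u true _

≤₂-∧∧ : ∀ k i j u → T (k ≤₂ i) → T (k ≤₂ j) → (T k → T u) → T (k ≤₂ (i ∧ᵇ (j ∧ᵇ u)))
≤₂-∧∧ false _ _ _ _ _ _ = tt
≤₂-∧∧ true true true u _ _ k⇒u = →⇒≤₂ true u k⇒u

∧∧-semidistrib : ∀ i j k u v w → (T w → T u) → (T w → T v) →
                 T ((i ∧ᵇ (k ∧ᵇ v)) ≤₂ (i ∧ᵇ (j ∧ᵇ u))) →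
                 T ((i ∧ᵇ ((j ∨ᵇ k) ∧ᵇ w)) ≤₂ (i ∧ᵇ (j ∧ᵇ u)))
∧∧-semidistrib false _ _ _ _ _ _ _ _ = tt
∧∧-semidistrib true true _ u _ w w⇒u _ _ = →⇒≤₂ w u w⇒u
∧∧-semidistrib true false false _ _ _ _ _ _ = tt
∧∧-semidistrib true false true _ v w _ w⇒v kv≤false =
  →⇒≤₂ w false (≤₂⇒→ v false kv≤false ∘ w⇒v)

T-⇒ᵇ : ∀ {x y} → T (not x ∨ᵇ (y ∧ᵇ x)) ⇔ (T x → T y)
T-⇒ᵇ {false} = mk⇔ (λ _ ()) (λ _ → tt)
T-⇒ᵇ {true} {false} = mk⇔ (λ ()) (λ x⇒y → x⇒y tt)
T-⇒ᵇ {true} {true} = mk⇔ (λ _ _ → tt) (λ _ → tt)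

⇒ᵇ≡false : ∀ {x y} → not x ∨ᵇ (y ∧ᵇ x) ≡ false → T x
⇒ᵇ≡false {true} _ = tt

module PosOrder (P : Pos) where
  infix 4 _⊑_
  _⊑_ : Carrier P → Carrier P → Set
  x ⊑ y = T (_≤ᵇ_ P x y)

-- The order of a Pos need not be antisymmetric, so equal meets are expressed by mutual ⊑.
record MeetSemidistributiveLattice (P : Pos) : Set where
  open PosOrder P
  infixr 6 _⊔_
  infixr 7 _⊓_
  field
    ⊑-refl        : ∀ {x} → x ⊑ x
    ⊑-trans       : ∀ {x y z} → x ⊑ y → y ⊑ z → x ⊑ z
    _⊓_ _⊔_       : Op₂ (Carrier P)
    x⊓y⊑x         : ∀ x y → x ⊓ y ⊑ x
    x⊓y⊑y         : ∀ x y → x ⊓ y ⊑ y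
    ⊓-greatest    : ∀ {x y z} → z ⊑ x → z ⊑ y → z ⊑ x ⊓ y
    x⊑x⊔y         : ∀ x y → x ⊑ x ⊔ y
    y⊑x⊔y         : ∀ x y → y ⊑ x ⊔ y
    ⊔-least       : ∀ {x y z} → x ⊑ z → y ⊑ z → x ⊔ y ⊑ z
    ⊓-semidistrib : ∀ {x y z} → x ⊓ y ⊑ x ⊓ z → x ⊓ z ⊑ x ⊓ y → x ⊓ (y ⊔ z) ⊑ x ⊓ y

msdl-one-element : ∀ {P} → Iso P OnePos → MeetSemidistributiveLattice P
msdl-one-element {P} (_ , ≤-preserved) = record
  { ⊑-refl = ⊑-total ; ⊑-trans = λ _ _ → ⊑-total
  ; _⊓_ = λ x _ → x ; _⊔_ = λ x _ → x
  ; x⊓y⊑x = λ _ _ → ⊑-total ; x⊓y⊑y = λ _ _ → ⊑-total ; ⊓-greatest = λ _ _ → ⊑-total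
  ; x⊑x⊔y = λ _ _ → ⊑-total ; y⊑x⊔y = λ _ _ → ⊑-total ; ⊔-least = λ _ _ → ⊑-total
  ; ⊓-semidistrib = λ _ _ → ⊑-total
  }
  where
  open PosOrder P
  ⊑-total : ∀ {x y} → x ⊑ y
  ⊑-total {x} {y} = subst T (sym (≤-preserved x y)) tt

msdl-transport : ∀ {P Q} → Iso P Q →
                 MeetSemidistributiveLattice Q → MeetSemidistributiveLattice P
msdl-transport {P} {Q} (f , ≤-preserved) M = record
  { ⊑-refl = reflect M.⊑-refl
  ; ⊑-trans = λ x⊑y y⊑z → reflect (M.⊑-trans (preserve x⊑y) (preserve y⊑z))
  ; _⊓_ = _⊓_ ; _⊔_ = _⊔_
  ; x⊓y⊑x = λ x y → reflect′ (to-⊓ x y) refl (M.x⊓y⊑x (to x) (to y))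
  ; x⊓y⊑y = λ x y → reflect′ (to-⊓ x y) refl (M.x⊓y⊑y (to x) (to y))
  ; ⊓-greatest = λ z⊑x z⊑y →
      reflect′ refl (to-⊓ _ _) (M.⊓-greatest (preserve z⊑x) (preserve z⊑y))
  ; x⊑x⊔y = λ x y → reflect′ refl (to-⊔ x y) (M.x⊑x⊔y (to x) (to y))
  ; y⊑x⊔y = λ x y → reflect′ refl (to-⊔ x y) (M.y⊑x⊔y (to x) (to y))
  ; ⊔-least = λ x⊑z y⊑z →
      reflect′ (to-⊔ _ _) refl (M.⊔-least (preserve x⊑z) (preserve y⊑z))
  ; ⊓-semidistrib = λ {x} {y} {z} h₁ h₂ →
      reflect′ (trans (to-⊓ x (y ⊔ z)) (cong (to x M.⊓_) (to-⊔ y z))) (to-⊓ x y)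
        (M.⊓-semidistrib (preserve′ (to-⊓ x y) (to-⊓ x z) h₁)
                         (preserve′ (to-⊓ x z) (to-⊓ x y) h₂))
  }
  where
  module M = MeetSemidistributiveLattice M
  module P = PosOrder P
  module Q = PosOrder Q
  open Inverse f using (to; from; strictlyInverseˡ)

  preserve : ∀ {x y} → x P.⊑ y → to x Q.⊑ to y
  preserve {x} {y} = subst T (≤-preserved x y)
  reflect : ∀ {x y} → to x Q.⊑ to y → x P.⊑ y
  reflect {x} {y} = subst T (sym (≤-preserved x y))

  preserve′ : ∀ {x y x′ y′} → to x ≡ x′ → to y ≡ y′ → x P.⊑ y → x′ Q.⊑ y′
  preserve′ refl refl = preserve
  reflect′ : ∀ {x y x′ y′} → to x ≡ x′ → to y ≡ y′ → x′ Q.⊑ y′ → x P.⊑ y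
  reflect′ refl refl = reflect

  _⊓_ _⊔_ : Op₂ (Carrier P)
  x ⊓ y = from (to x M.⊓ to y)
  x ⊔ y = from (to x M.⊔ to y)

  to-⊓ : ∀ x y → to (x ⊓ y) ≡ to x M.⊓ to y
  to-⊓ x y = strictlyInverseˡ _
  to-⊔ : ∀ x y → to (x ⊔ y) ≡ to x M.⊔ to y
  to-⊔ x y = strictlyInverseˡ _

module Doubling {Q : Pos} (a b : Carrier Q) (M : MeetSemidistributiveLattice Q) where
  open PosOrder Q
  open MeetSemidistributiveLattice M
  private
    module D = PosOrder (Double Q a b)

  upper : Carrier Q → Bool
  upper r = inDouble Q a b (r , true)

  T-upper : ∀ {r} → T (upper r) ⇔ (r ⊑ b → a ⊑ r)
  T-upper = T-⇒ᵇ

  inDouble-upper : ∀ r → T (inDouble Q a b (r , upper r))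
  inDouble-upper r with upper r in eq
  ... | true = subst T (sym eq) tt
  ... | false = ⇒ᵇ≡false eq

  upper-mono : ∀ {r s} → r ⊑ s → T (upper r) → T (upper s)
  upper-mono r⊑s r-upper = Equivalence.from T-upper λ s⊑b →
    ⊑-trans (Equivalence.to T-upper r-upper (⊑-trans r⊑s s⊑b)) r⊑s

  Elem : Set
  Elem = Carrier (Double Q a b)

  underlying : Elem → Carrier Q
  underlying ((p , _) , _) = p

  level : Elem → Bool
  level ((_ , i) , _) = i

  ⊑ᴰ⇔ : ∀ x y → x D.⊑ y ⇔ (underlying x ⊑ underlying y × T (level x ≤₂ level y))
  ⊑ᴰ⇔ x y = T-∧ {_≤ᵇ_ Q (underlying x) (underlying y)}

  ⊑ᴰ-intro : ∀ x y → underlying x ⊑ underlying y → T (level x ≤₂ level y) → x D.⊑ y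
  ⊑ᴰ-intro x y p⊑q i≤j = Equivalence.from (⊑ᴰ⇔ x y) (p⊑q , i≤j)

  ⊑ᴰ-underlying : ∀ x y → x D.⊑ y → underlying x ⊑ underlying y
  ⊑ᴰ-underlying x y = proj₁ ∘ Equivalence.to (⊑ᴰ⇔ x y)

  ⊑ᴰ-level : ∀ x y → x D.⊑ y → T (level x ≤₂ level y)
  ⊑ᴰ-level x y = proj₂ ∘ Equivalence.to (⊑ᴰ⇔ x y)

  level⇒upper : ∀ p i → T (inDouble Q a b (p , i)) → T i → T (upper p)
  level⇒upper p true h _ = h

  meet-admissible : ∀ p i q j → T (inDouble Q a b (p , i)) → T (inDouble Q a b (q , j)) →
                    T (inDouble Q a b (p ⊓ q , i ∧ᵇ (j ∧ᵇ upper (p ⊓ q))))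
  meet-admissible p false q j hp hq = ⊑-trans (x⊓y⊑x p q) hp
  meet-admissible p true q false hp hq = ⊑-trans (x⊓y⊑y p q) hq
  meet-admissible p true q true hp hq = inDouble-upper (p ⊓ q)

  join-admissible : ∀ p i q j → T (inDouble Q a b (p , i)) → T (inDouble Q a b (q , j)) →
                    T (inDouble Q a b (p ⊔ q , i ∨ᵇ j))
  join-admissible p false q false hp hq = ⊔-least hp hq
  join-admissible p true q j hp hq = upper-mono (x⊑x⊔y p q) hp
  join-admissible p false q true hp hq = upper-mono (y⊑x⊔y p q) hq

  -- (p , i) ⊓ (q , j) lies in the upper copy only if both arguments do and p ⊓ q has an
  -- upper copy; the upper copies form an up-set, so joins need no such correction.
  _⊓ᴰ_ _⊔ᴰ_ : Op₂ Elem
  ((p , i) , hp) ⊓ᴰ ((q , j) , hq) =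
    (p ⊓ q , i ∧ᵇ (j ∧ᵇ upper (p ⊓ q))) , meet-admissible p i q j hp hq
  ((p , i) , hp) ⊔ᴰ ((q , j) , hq) = (p ⊔ q , i ∨ᵇ j) , join-admissible p i q j hp hq

  msdl : MeetSemidistributiveLattice (Double Q a b)
  msdl = record
    { ⊑-refl = λ {x} → ⊑ᴰ-intro x x ⊑-refl (≤₂-refl (level x))
    ; ⊑-trans = λ {x} {y} {z} x⊑y y⊑z → ⊑ᴰ-intro x z
        (⊑-trans (⊑ᴰ-underlying x y x⊑y) (⊑ᴰ-underlying y z y⊑z))
        (≤₂-trans (level x) (level y) (level z) (⊑ᴰ-level x y x⊑y) (⊑ᴰ-level y z y⊑z))
    ; _⊓_ = _⊓ᴰ_ ; _⊔_ = _⊔ᴰ_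
    ; x⊓y⊑x = λ x y → ⊑ᴰ-intro (x ⊓ᴰ y) x (x⊓y⊑x _ _) (∧∧-≤₂ˡ (level x) (level y) (upper-meet x y))
    ; x⊓y⊑y = λ x y → ⊑ᴰ-intro (x ⊓ᴰ y) y (x⊓y⊑y _ _) (∧∧-≤₂ʳ (level x) (level y) (upper-meet x y))
    ; ⊓-greatest = λ {x} {y} {z} z⊑x z⊑y →
        let z⊑x⊓y = ⊓-greatest (⊑ᴰ-underlying z x z⊑x) (⊑ᴰ-underlying z y z⊑y) in
        ⊑ᴰ-intro z (x ⊓ᴰ y) z⊑x⊓y
          (≤₂-∧∧ (level z) (level x) (level y) (upper-meet x y)
                 (⊑ᴰ-level z x z⊑x) (⊑ᴰ-level z y z⊑y)
                 (upper-mono z⊑x⊓y ∘ level⇒upper _ (level z) (proj₂ z)))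
    ; x⊑x⊔y = λ x y → ⊑ᴰ-intro x (x ⊔ᴰ y) (x⊑x⊔y _ _) (≤₂-∨ˡ (level x) (level y))
    ; y⊑x⊔y = λ x y → ⊑ᴰ-intro y (x ⊔ᴰ y) (y⊑x⊔y _ _) (≤₂-∨ʳ (level x) (level y))
    ; ⊔-least = λ {x} {y} {z} x⊑z y⊑z → ⊑ᴰ-intro (x ⊔ᴰ y) z
        (⊔-least (⊑ᴰ-underlying x z x⊑z) (⊑ᴰ-underlying y z y⊑z))
        (∨-≤₂ (level x) (level y) (level z) (⊑ᴰ-level x z x⊑z) (⊑ᴰ-level y z y⊑z))
    ; ⊓-semidistrib = λ {x} {y} {z} xy⊑xz xz⊑xy →
        let xy⊑xz′ = ⊑ᴰ-underlying (x ⊓ᴰ y) (x ⊓ᴰ z) xy⊑xz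
            xz⊑xy′ = ⊑ᴰ-underlying (x ⊓ᴰ z) (x ⊓ᴰ y) xz⊑xy
            x[y⊔z]⊑xy = ⊓-semidistrib xy⊑xz′ xz⊑xy′ in
        ⊑ᴰ-intro (x ⊓ᴰ (y ⊔ᴰ z)) (x ⊓ᴰ y) x[y⊔z]⊑xy
          (∧∧-semidistrib (level x) (level y) (level z)
             (upper-meet x y) (upper-meet x z) (upper-meet x (y ⊔ᴰ z))
             (upper-mono x[y⊔z]⊑xy) (upper-mono (⊑-trans x[y⊔z]⊑xy xy⊑xz′))
             (⊑ᴰ-level (x ⊓ᴰ z) (x ⊓ᴰ y) xz⊑xy))
    }
    where
    upper-meet : Elem → Elem → Bool
    upper-meet x y = upper (underlying x ⊓ underlying y)

congruenceUniform⇒msdl : ∀ {P} → CongUniform P → MeetSemidistributiveLattice P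
congruenceUniform⇒msdl (base _ iso) = msdl-one-element iso
congruenceUniform⇒msdl (double _ _ a b _ cu iso) =
  msdl-transport iso (Doubling.msdl a b (congruenceUniform⇒msdl cu))

sum-map≡0⇔ : ∀ {A : Set} (f : A → ℕ) xs → sum (map f xs) ≡ 0 ⇔ (∀ {x} → x ∈ₗ xs → f x ≡ 0)
sum-map≡0⇔ f [] = mk⇔ (λ _ ()) (λ _ → refl)
sum-map≡0⇔ f (x ∷ xs) = mk⇔
  (λ sum≡0 → λ { (Any.here refl) → m+n≡0⇒m≡0 (f x) sum≡0
               ; (Any.there x′∈xs) →
                   Equivalence.to (sum-map≡0⇔ f xs) (m+n≡0⇒n≡0 (f x) sum≡0) x′∈xs })
  (λ all≡0 → trans (cong (_+ sum (map f xs)) (all≡0 (Any.here refl)))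
                   (Equivalence.from (sum-map≡0⇔ f xs) (λ x′∈xs → all≡0 (Any.there x′∈xs))))

∣p─q∣≡0⇒p⊆q : ∀ {m} (p q : Subset m) → ∣ p ─ q ∣ ≡ 0 → p ⊆ q
∣p─q∣≡0⇒p⊆q (_ Vec.∷ p) (inside Vec.∷ q) _ Vec.here = Vec.here
∣p─q∣≡0⇒p⊆q (_ Vec.∷ p) (inside Vec.∷ q) ∣p─q∣≡0 (Vec.there x∈p) =
  Vec.there (∣p─q∣≡0⇒p⊆q p q ∣p─q∣≡0 x∈p)
∣p─q∣≡0⇒p⊆q (outside Vec.∷ p) (outside Vec.∷ q) ∣p─q∣≡0 (Vec.there x∈p) =
  Vec.there (∣p─q∣≡0⇒p⊆q p q ∣p─q∣≡0 x∈p)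
∣p─q∣≡0⇒p⊆q (inside Vec.∷ p) (outside Vec.∷ q) () _

p⊆q⇒∣p─q∣≡0 : ∀ {m} (p q : Subset m) → p ⊆ q → ∣ p ─ q ∣ ≡ 0
p⊆q⇒∣p─q∣≡0 Vec.[] Vec.[] _ = refl
p⊆q⇒∣p─q∣≡0 (_ Vec.∷ p) (inside Vec.∷ q) p⊆q = p⊆q⇒∣p─q∣≡0 p q (drop-∷-⊆ p⊆q)
p⊆q⇒∣p─q∣≡0 (outside Vec.∷ p) (outside Vec.∷ q) p⊆q = p⊆q⇒∣p─q∣≡0 p q (drop-∷-⊆ p⊆q)
p⊆q⇒∣p─q∣≡0 (inside Vec.∷ p) (outside Vec.∷ q) p⊆q = case p⊆q Vec.here of λ ()

∈-tabulate⇔ : ∀ {m} {f : Fin m → Bool} {x} → x ∈ tabulate f ⇔ T (f x)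
∈-tabulate⇔ {f = f} {x} = mk⇔
  (λ x∈ → Equivalence.from T-≡ (trans (sym (lookup∘tabulate f x)) ([]=⇒lookup x∈)))
  (λ fx → lookup⇒[]= x (tabulate f) (trans (lookup∘tabulate f x) (Equivalence.to T-≡ fx)))

-- Covers, nuclei and join-irreducibles in a finite lattice

T-not : ∀ {b} → T (not b) ⇔ (¬ T b)
T-not {false} = mk⇔ (λ _ ()) (λ _ → tt)
T-not {true} = mk⇔ (λ ()) (λ ¬tt → ¬tt tt)

module FiniteLattice (L : FinLattice) where
  open FinLattice L
  open FinLatticeDefs L

  lattice : Lattice 0ℓ 0ℓ 0ℓ
  lattice = record
    { Carrier = Fin n ; _≈_ = _≡_ ; _≤_ = _≤_ ; _∨_ = _∨_ ; _∧_ = _∧_ ; isLattice = isLattice }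

  open Lattice lattice public
    using (poset; isPartialOrder; antisym; x≤x∨y; y≤x∨y; ∨-least; x∧y≤x; x∧y≤y; ∧-greatest)
    renaming (refl to ≤-refl; trans to ≤-trans; reflexive to ≤-reflexive)
  open import Relation.Binary.Properties.Poset poset public
    using (_<_; <⇒≱)
  open import Relation.Binary.Lattice.Properties.JoinSemilattice (Lattice.joinSemilattice lattice)
    using (∨-comm)

  _<?_ : ∀ x y → Dec (x < y)
  _<?_ = ToStrict.<-decidable _≡_ _≤_ F._≟_ _≤?_

  <-wellFounded : WellFounded _<_
  <-wellFounded = po-wellFounded isPartialOrder

  >-wellFounded : WellFounded (flip _<_)
  >-wellFounded = po-noetherian isPartialOrder

  T-lt : ∀ {x y} → T (lt x y) ⇔ x < y
  T-lt {x} {y} = mk⇔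
    (λ h → let x≤y , x≢y = Equivalence.to (T-∧ {le x y}) h in toWitness x≤y , toWitnessFalse x≢y)
    (λ (x≤y , x≢y) → Equivalence.from (T-∧ {le x y}) (fromWitness x≤y , fromWitnessFalse x≢y))

  T-anyF : ∀ {f} → T (anyF f) ⇔ ∃ (T ∘ f)
  T-anyF {f} = mk⇔
    (Any.satisfied ∘ Any.any⁻ f (allFin n))
    (λ (x , fx) → Any.any⁺ f (Any.map (λ { refl → fx }) (∈-allFin x)))

  T-allF : ∀ {f} → T (allF f) ⇔ (∀ x → T (f x))
  T-allF {f} = mk⇔
    (λ h x → All.lookup (All.all⁺ f (allFin n) h) (∈-allFin x))
    (λ h → All.all⁻ f {xs = allFin n} (All.tabulate λ {x} _ → h x))

  infix 4 _⋖_
  _⋖_ : Fin n → Fin n → Set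
  y ⋖ x = y < x × (∀ {z} → y < z → ¬ z < x)

  T-covers : ∀ {y x} → T (covers y x) ⇔ y ⋖ x
  T-covers {y} {x} = mk⇔
    (λ h → let y<x , nothing-between = Equivalence.to (T-∧ {lt y x}) h in
      Equivalence.to T-lt y<x , λ {z} y<z z<x →
        Equivalence.to T-not nothing-between
          (Equivalence.from T-anyF (z , Equivalence.from (T-∧ {lt y z})
            (Equivalence.from T-lt y<z , Equivalence.from T-lt z<x))))
    (λ (y<x , nothing-between) → Equivalence.from (T-∧ {lt y x}) (Equivalence.from T-lt y<x ,
      Equivalence.from T-not λ h → let z , y<z<x = Equivalence.to T-anyF h
                                       y<z , z<x = Equivalence.to (T-∧ {lt y z}) y<z<x in
        nothing-between (Equivalence.to T-lt y<z) (Equivalence.to T-lt z<x)))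

  ⋖-interval : ∀ {y x z} → y ⋖ x → y ≤ z → z ≤ x → z ≡ y ⊎ z ≡ x
  ⋖-interval {y} {x} {z} (_ , nothing-between) y≤z z≤x with y F.≟ z | z F.≟ x
  ... | yes y≡z | _ = inj₁ (sym y≡z)
  ... | no _ | yes z≡x = inj₂ z≡x
  ... | no y≢z | no z≢x = ⊥-elim (nothing-between (y≤z , y≢z) (z≤x , z≢x))

  ⋖⇒∨≡ : ∀ {u v j} → u ⋖ v → j ≤ v → ¬ j ≤ u → j ∨ u ≡ v
  ⋖⇒∨≡ {u} {v} {j} u⋖v j≤v j≰u
    with ⋖-interval u⋖v (y≤x∨y j u) (∨-least j≤v (proj₁ (proj₁ u⋖v)))
  ... | inj₁ j∨u≡u = ⊥-elim (j≰u (subst (j ≤_) j∨u≡u (x≤x∨y j u)))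
  ... | inj₂ j∨u≡v = j∨u≡v

  <⇒≤⋖ : ∀ {a x} → a < x → ∃ λ y → a ≤ y × y ⋖ x
  <⇒≤⋖ {a} {x} = go (>-wellFounded a)
    where
    go : ∀ {a} → Acc (flip _<_) a → a < x → ∃ λ y → a ≤ y × y ⋖ x
    go {a} (acc rec) a<x with any? (λ z → (a <? z) ×-dec (z <? x))
    ... | yes (z , a<z , z<x) =
      let y , z≤y , y⋖x = go (rec a<z) z<x in y , ≤-trans (proj₁ a<z) z≤y , y⋖x
    ... | no nothing-between =
      a , ≤-refl , a<x , λ {z} a<z z<x → nothing-between (z , a<z , z<x)

  separating-⋖ : ∀ {p q j} → p ≤ q → j ≤ q → ¬ j ≤ p →
                 ∃₂ λ u v → p ≤ u × u ⋖ v × v ≤ q × j ≤ v × ¬ j ≤ u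
  separating-⋖ {p} {q} {j} = go (<-wellFounded q)
    where
    go : ∀ {q} → Acc _<_ q → p ≤ q → j ≤ q → ¬ j ≤ p →
         ∃₂ λ u v → p ≤ u × u ⋖ v × v ≤ q × j ≤ v × ¬ j ≤ u
    go {q} (acc rec) p≤q j≤q j≰p with <⇒≤⋖ (p≤q , λ { refl → j≰p j≤q })
    ... | y , p≤y , y⋖q with j ≤? y
    ...   | no j≰y = y , q , p≤y , y⋖q , ≤-refl , j≤q , j≰y
    ...   | yes j≤y =
      let u , v , p≤u , u⋖v , v≤y , rest = go (rec (proj₁ y⋖q)) p≤y j≤y j≰p in
      u , v , p≤u , u⋖v , ≤-trans v≤y (proj₁ (proj₁ y⋖q)) , rest

  ≤-foldr-meet : ∀ (p : Fin n → Bool) x ys {z} →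
                 z ≤ foldr (λ y m → if p y then y ∧ m else m) x ys ⇔
                 (z ≤ x × ∀ {y} → y ∈ₗ ys → T (p y) → z ≤ y)
  ≤-foldr-meet p x [] = mk⇔ (λ z≤x → z≤x , λ ()) proj₁
  ≤-foldr-meet p x (y ∷ ys) {z} with p y in py | ≤-foldr-meet p x ys {z}
  ... | true | ih = mk⇔
    (λ z≤y∧m → let z≤x , below = Equivalence.to ih (≤-trans z≤y∧m (x∧y≤y y _)) in
      z≤x , λ { (Any.here refl) _ → ≤-trans z≤y∧m (x∧y≤x y _) ; (Any.there y′∈ys) → below y′∈ys })
    (λ (z≤x , below) → ∧-greatest (below (Any.here refl) (subst T (sym py) tt))
                                   (Equivalence.from ih (z≤x , λ y′∈ys → below (Any.there y′∈ys))))
  ... | false | ih = mk⇔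
    (λ z≤m → let z≤x , below = Equivalence.to ih z≤m in
      z≤x , λ { (Any.here refl) py′ → ⊥-elim (subst T py py′) ; (Any.there y′∈ys) → below y′∈ys })
    (λ (z≤x , below) → Equivalence.from ih (z≤x , λ y′∈ys → below (Any.there y′∈ys)))

  ≤nucleus⇔ : ∀ {x z} → z ≤ nucleus x ⇔ (z ≤ x × ∀ {y} → y ⋖ x → z ≤ y)
  ≤nucleus⇔ {x} = mk⇔
    (λ z≤N → let z≤x , below = Equivalence.to fold z≤N in
      z≤x , λ {y} y⋖x → below (∈-allFin y) (Equivalence.from T-covers y⋖x))
    (λ (z≤x , below) →
      Equivalence.from fold (z≤x , λ _ y⋖x → below (Equivalence.to T-covers y⋖x)))
    where fold = ≤-foldr-meet (λ y → covers y x) x (allFin n)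

  nucleus≤ : ∀ x → nucleus x ≤ x
  nucleus≤ x = proj₁ (Equivalence.to ≤nucleus⇔ ≤-refl)

  nucleus≤⋖ : ∀ {x y} → y ⋖ x → nucleus x ≤ y
  nucleus≤⋖ = proj₂ (Equivalence.to ≤nucleus⇔ ≤-refl)

  _⋖?_ : ∀ y x → Dec (y ⋖ x)
  y ⋖? x = Dec.map T-covers (T? (covers y x))

  ≰nucleus⇒⋖ : ∀ {x z} → z ≤ x → ¬ z ≤ nucleus x → ∃ λ y → y ⋖ x × ¬ z ≤ y
  ≰nucleus⇒⋖ {x} {z} z≤x z≰N with any? (λ y → (y ⋖? x) ×-dec ¬? (z ≤? y))
  ... | yes witness = witness
  ... | no none = ⊥-elim (z≰N (Equivalence.from ≤nucleus⇔ (z≤x , λ {y} y⋖x →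
                      decidable-stable (z ≤? y) (λ z≰y → none (y , y⋖x , z≰y)))))

  nucleus-absorbs : ∀ {x s t} → s ≤ nucleus x → t ∨ s ≡ x → t ≡ x
  nucleus-absorbs {x} {s} {t} s≤N t∨s≡x with t F.≟ x
  ... | yes t≡x = t≡x
  ... | no t≢x with <⇒≤⋖ (subst (t ≤_) t∨s≡x (x≤x∨y t s) , t≢x)
  ...   | y , t≤y , y⋖x = ⊥-elim (<⇒≱ (proj₁ y⋖x)
            (subst (_≤ y) t∨s≡x (∨-least t≤y (≤-trans s≤N (nucleus≤⋖ y⋖x)))))

  record IsJoinIrreducible (j : Fin n) : Set where
    field
      not-bottom  : ¬ (∀ z → j ≤ z)
      irreducible : ∀ {x y} → x ∨ y ≡ j → x ≡ j ⊎ y ≡ j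

  open IsJoinIrreducible

  T-joinIrr : ∀ {j} → T (joinIrr j) ⇔ IsJoinIrreducible j
  T-joinIrr {j} = mk⇔ to from
    where
    to : T (joinIrr j) → IsJoinIrreducible j
    to h = let not-bot , irr = Equivalence.to (T-∧ {not (isBottom j)}) h in record
      { not-bottom = λ j≤all →
          Equivalence.to T-not not-bot (Equivalence.from T-allF (fromWitness ∘ j≤all))
      ; irreducible = λ {x} {y} x∨y≡j →
          [ (λ x∨y≢j → ⊥-elim (toWitnessFalse x∨y≢j x∨y≡j))
          , (λ h′ → [ inj₁ ∘ toWitness , inj₂ ∘ toWitness ] (Equivalence.to (T-∨ {eq x j}) h′))
          ] (Equivalence.to (T-∨ {not (eq (x ∨ y) j)})
                (Equivalence.to T-allF (Equivalence.to T-allF irr x) y))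
      }
    from : IsJoinIrreducible j → T (joinIrr j)
    from jJI = Equivalence.from (T-∧ {not (isBottom j)})
      ( Equivalence.from T-not (λ bot → not-bottom jJI (toWitness ∘ Equivalence.to T-allF bot))
      , Equivalence.from T-allF λ x → Equivalence.from T-allF λ y → irreducibleᵇ x y)
      where
      irreducibleᵇ : ∀ x y → T (not (eq (x ∨ y) j) ∨ᵇ (eq x j ∨ᵇ eq y j))
      irreducibleᵇ x y with (x ∨ y) F.≟ j
      ... | no _ = tt
      ... | yes x∨y≡j = Equivalence.from (T-∨ {eq x j})
                          ([ inj₁ ∘ fromWitness , inj₂ ∘ fromWitness ] (irreducible jJI x∨y≡j))

  isJoinIrreducible? : ∀ j → Dec (IsJoinIrreducible j)
  isJoinIrreducible? j = Dec.map T-joinIrr (T? (joinIrr j))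

  ≤⇒∧≡ : ∀ {x y} → x ≤ y → x ∧ y ≡ x
  ≤⇒∧≡ {x} {y} x≤y = antisym (x∧y≤x x y) (∧-greatest ≤-refl x≤y)

  ji-lowerCover : ∀ {j} → IsJoinIrreducible j → ∃ (_⋖ j)
  ji-lowerCover {j} jJI with ¬∀⟶∃¬ n (j ≤_) (j ≤?_) (not-bottom jJI)
  ... | z , j≰z with <⇒≤⋖ (x∧y≤x j z , λ j∧z≡j → j≰z (subst (_≤ z) j∧z≡j (x∧y≤y j z)))
  ...   | c , _ , c⋖j = c , c⋖j

  <ji⇒≤lowerCover : ∀ {j c g} → IsJoinIrreducible j → c ⋖ j → g < j → g ≤ c
  <ji⇒≤lowerCover {j} {c} {g} jJI c⋖j (g≤j , g≢j)
    with ⋖-interval c⋖j (y≤x∨y g c) (∨-least g≤j (proj₁ (proj₁ c⋖j)))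
  ... | inj₁ g∨c≡c = subst (g ≤_) g∨c≡c (x≤x∨y g c)
  ... | inj₂ g∨c≡j = [ (λ g≡j → ⊥-elim (g≢j g≡j)) , (λ c≡j → ⊥-elim (proj₂ (proj₁ c⋖j) c≡j)) ]
                       (irreducible jJI g∨c≡j)

  ∧≡lowerCover : ∀ {j c t} → IsJoinIrreducible j → c ⋖ j → c ≤ t → ¬ j ≤ t → j ∧ t ≡ c
  ∧≡lowerCover {j} {c} {t} jJI c⋖j c≤t j≰t = antisym
    (<ji⇒≤lowerCover jJI c⋖j (x∧y≤x j t , λ j∧t≡j → j≰t (subst (_≤ t) j∧t≡j (x∧y≤y j t))))
    (∧-greatest (proj₁ (proj₁ c⋖j)) c≤t)

  JoinPrime : Fin n → Set
  JoinPrime j = ∀ {a b} → j ≤ (a ∨ b) → j ≤ a ⊎ j ≤ b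

  distributive⇒joinPrime : Distributive → ∀ {j} → IsJoinIrreducible j → JoinPrime j
  distributive⇒joinPrime distrib {j} jJI {a} {b} j≤a∨b =
    [ inj₁ ∘ meet-absorbed a , inj₂ ∘ meet-absorbed b ] (irreducible jJI j∧a∨j∧b≡j)
    where
    j∧a∨j∧b≡j : (j ∧ a) ∨ (j ∧ b) ≡ j
    j∧a∨j∧b≡j = trans (sym (distrib j a b)) (≤⇒∧≡ j≤a∨b)
    meet-absorbed : ∀ t → j ∧ t ≡ j → j ≤ t
    meet-absorbed t j∧t≡j = subst (_≤ t) j∧t≡j (x∧y≤y j t)

  ¬ji⇒bottom⊎split : ∀ {t} → ¬ IsJoinIrreducible t →
                     (∀ z → t ≤ z) ⊎ ∃₂ λ p q → p ∨ q ≡ t × p ≢ t × q ≢ t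
  ¬ji⇒bottom⊎split {t} ¬tJI with all? (t ≤?_)
  ... | yes bottom = inj₁ bottom
  ... | no not-bottom
    with any? (λ p → any? (λ q → ((p ∨ q) F.≟ t) ×-dec ¬? (p F.≟ t) ×-dec ¬? (q F.≟ t)))
  ...   | yes (p , q , split) = inj₂ (p , q , split)
  ...   | no no-split = ⊥-elim (¬tJI record { not-bottom = not-bottom ; irreducible = irreducibleᵗ })
    where
    irreducibleᵗ : ∀ {x y} → x ∨ y ≡ t → x ≡ t ⊎ y ≡ t
    irreducibleᵗ {x} {y} x∨y≡t with x F.≟ t | y F.≟ t
    ... | yes x≡t | _ = inj₁ x≡t
    ... | no _ | yes y≡t = inj₂ y≡t
    ... | no x≢t | no y≢t = ⊥-elim (no-split (x , y , x∨y≡t , x≢t , y≢t))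

  ji-separating : ∀ {t s} → ¬ t ≤ s → ∃ λ j → IsJoinIrreducible j × j ≤ t × ¬ j ≤ s
  ji-separating {t} {s} = go (<-wellFounded t)
    where
    go : ∀ {t} → Acc _<_ t → ¬ t ≤ s → ∃ λ j → IsJoinIrreducible j × j ≤ t × ¬ j ≤ s
    go {t} (acc rec) t≰s with isJoinIrreducible? t
    ... | yes tJI = t , tJI , ≤-refl , t≰s
    ... | no ¬tJI = [ (λ bottom → ⊥-elim (t≰s (bottom s))) , split ] (¬ji⇒bottom⊎split ¬tJI)
      where
      descend : ∀ {r} → r < t → ¬ r ≤ s → ∃ λ j → IsJoinIrreducible j × j ≤ t × ¬ j ≤ s
      descend r<t r≰s =
        let j , jJI , j≤r , j≰s = go (rec r<t) r≰s in j , jJI , ≤-trans j≤r (proj₁ r<t) , j≰s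
      split : (∃₂ λ p q → p ∨ q ≡ t × p ≢ t × q ≢ t) →
              ∃ λ j → IsJoinIrreducible j × j ≤ t × ¬ j ≤ s
      split (p , q , p∨q≡t , p≢t , q≢t) with p ≤? s | q ≤? s
      ... | no p≰s | _ = descend (subst (p ≤_) p∨q≡t (x≤x∨y p q) , p≢t) p≰s
      ... | _ | no q≰s = descend (subst (q ≤_) p∨q≡t (y≤x∨y p q) , q≢t) q≰s
      ... | yes p≤s | yes q≤s = ⊥-elim (t≰s (subst (_≤ s) p∨q≡t (∨-least p≤s q≤s)))

  joinPrime⇒distributive : (∀ {j} → IsJoinIrreducible j → JoinPrime j) → Distributive
  joinPrime⇒distributive prime x y z = antisym x∧[y∨z]≤ ≤x∧[y∨z]
    where
    ≤x∧[y∨z] : ((x ∧ y) ∨ (x ∧ z)) ≤ (x ∧ (y ∨ z))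
    ≤x∧[y∨z] = ∨-least (∧-greatest (x∧y≤x x y) (≤-trans (x∧y≤y x y) (x≤x∨y y z)))
                       (∧-greatest (x∧y≤x x z) (≤-trans (x∧y≤y x z) (y≤x∨y y z)))
    x∧[y∨z]≤ : (x ∧ (y ∨ z)) ≤ ((x ∧ y) ∨ (x ∧ z))
    x∧[y∨z]≤ = decidable-stable (_ ≤? _) λ ≰ →
      let j , jJI , j≤ , j≰ = ji-separating ≰
          j≤x = ≤-trans j≤ (x∧y≤x x _) in
      [ (λ j≤y → j≰ (≤-trans (∧-greatest j≤x j≤y) (x≤x∨y _ _)))
      , (λ j≤z → j≰ (≤-trans (∧-greatest j≤x j≤z) (y≤x∨y _ _))) ]
      (prime jJI (≤-trans j≤ (x∧y≤y x _)))

  -- Ψ, canonical join representations and join-primality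

  Perspective : Fin n → Fin n → Fin n → Fin n → Set
  Perspective x y u v = (v ∨ x ≡ y × v ∧ x ≡ u) ⊎ (u ∨ y ≡ v × u ∧ y ≡ x)

  T-eq∧eq : ∀ a b c d → T (eq a b ∧ᵇ eq c d) ⇔ (a ≡ b × c ≡ d)
  T-eq∧eq a b c d = mk⇔
    (λ h → let a≡b , c≡d = Equivalence.to (T-∧ {eq a b}) h in toWitness a≡b , toWitness c≡d)
    (λ (a≡b , c≡d) → Equivalence.from (T-∧ {eq a b}) (fromWitness a≡b , fromWitness c≡d))

  T-persp : ∀ {x y u v} → T (persp x y u v) ⇔ Perspective x y u v
  T-persp {x} {y} {u} {v} = mk⇔
    ([ inj₁ ∘ Equivalence.to first , inj₂ ∘ Equivalence.to second ] ∘ Equivalence.to either)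
    (Equivalence.from either ∘ [ inj₁ ∘ Equivalence.from first , inj₂ ∘ Equivalence.from second ])
    where
    either = T-∨ {eq (v ∨ x) y ∧ᵇ eq (v ∧ x) u}
    first = T-eq∧eq (v ∨ x) y (v ∧ x) u
    second = T-eq∧eq (u ∨ y) v (u ∧ y) x

  IsGamma : Fin n → Fin n → Fin n → Set
  IsGamma u v j = IsJoinIrreducible j × ∃ λ c → c ⋖ j × Perspective u v c j

  T-gammaIs : ∀ {u v j} → T (gammaIs u v j) ⇔ IsGamma u v j
  T-gammaIs {u} {v} {j} = mk⇔
    (λ h → let jJI , lower = Equivalence.to (T-∧ {joinIrr j}) h
               c , c⋖j∧persp = Equivalence.to T-anyF lower
               c⋖j , persp = Equivalence.to (T-∧ {covers c j}) c⋖j∧persp in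
      Equivalence.to T-joinIrr jJI , c , Equivalence.to T-covers c⋖j , Equivalence.to T-persp persp)
    (λ (jJI , c , c⋖j , persp) → Equivalence.from (T-∧ {joinIrr j}) (Equivalence.from T-joinIrr jJI ,
      Equivalence.from T-anyF (c , Equivalence.from (T-∧ {covers c j})
        (Equivalence.from T-covers c⋖j , Equivalence.from T-persp persp))))

  ∈Ψ⇔ : ∀ {x j} → j ∈ Ψ x ⇔ ∃₂ λ u v → nucleus x ≤ u × u ⋖ v × v ≤ x × IsGamma u v j
  ∈Ψ⇔ {x} {j} = mk⇔
    (λ j∈Ψ → let u , h = Equivalence.to T-anyF (Equivalence.to ∈-tabulate⇔ j∈Ψ)
                 v , h′ = Equivalence.to T-anyF h
                 N≤u , h″ = Equivalence.to (T-∧ {le (nucleus x) u}) h′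
                 u⋖v , h‴ = Equivalence.to (T-∧ {covers u v}) h″
                 v≤x , γ = Equivalence.to (T-∧ {le v x}) h‴ in
      u , v , toWitness N≤u , Equivalence.to T-covers u⋖v , toWitness v≤x , Equivalence.to T-gammaIs γ)
    (λ (u , v , N≤u , u⋖v , v≤x , γ) → Equivalence.from ∈-tabulate⇔ (Equivalence.from T-anyF (u ,
      Equivalence.from T-anyF (v , Equivalence.from (T-∧ {le (nucleus x) u}) (fromWitness N≤u ,
        Equivalence.from (T-∧ {covers u v}) (Equivalence.from T-covers u⋖v ,
          Equivalence.from (T-∧ {le v x}) (fromWitness v≤x , Equivalence.from T-gammaIs γ)))))))

  gamma-separates : ∀ {u v j} → u ⋖ v → IsGamma u v j → j ≤ v × ¬ j ≤ u
  gamma-separates {u} {v} {j} u⋖v (jJI , c , c⋖j , inj₁ (j∨u≡v , j∧u≡c)) =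
    subst (j ≤_) j∨u≡v (x≤x∨y j u) ,
    λ j≤u → proj₂ (proj₁ c⋖j) (trans (sym j∧u≡c) (≤⇒∧≡ j≤u))
  gamma-separates {u} {v} {j} u⋖v (jJI , c , c⋖j , inj₂ (c∨v≡j , c∧v≡u)) with v F.≟ j
  ... | yes refl = ≤-refl , <⇒≱ (proj₁ u⋖v)
  ... | no v≢j = ⊥-elim (proj₂ (proj₁ u⋖v) (trans (sym c∧v≡u) c∧v≡v))
    where
    v≤c : v ≤ c
    v≤c = <ji⇒≤lowerCover jJI c⋖j (subst (v ≤_) c∨v≡j (y≤x∨y c v) , v≢j)
    c∧v≡v : c ∧ v ≡ v
    c∧v≡v = antisym (x∧y≤y c v) (∧-greatest v≤c ≤-refl)

  ∈Ψ⇒ : ∀ {x j} → j ∈ Ψ x → IsJoinIrreducible j × j ≤ x × ¬ j ≤ nucleus x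
  ∈Ψ⇒ j∈Ψ =
    let u , v , N≤u , u⋖v , v≤x , γ = Equivalence.to ∈Ψ⇔ j∈Ψ
        j≤v , j≰u = gamma-separates u⋖v γ in
    proj₁ γ , ≤-trans j≤v v≤x , λ j≤N → j≰u (≤-trans j≤N N≤u)

  ∈Ψ⇐ : ∀ {x j c} → IsJoinIrreducible j → c ⋖ j → j ≤ x → ¬ j ≤ (nucleus x ∨ c) → j ∈ Ψ x
  -- A cover u ⋖ v between x↓ ∨ c and x↓ ∨ j that separates j is perspective to c ⋖ j.
  ∈Ψ⇐ {x} {j} {c} jJI c⋖j j≤x j≰N∨c =
    let u , v , N∨c≤u , u⋖v , v≤N∨j , j≤v , j≰u = separating-⋖ N∨c≤N∨j (y≤x∨y N j) j≰N∨c
        c≤u = ≤-trans (y≤x∨y N c) N∨c≤u in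
    Equivalence.from ∈Ψ⇔
      ( u , v , ≤-trans (x≤x∨y N c) N∨c≤u , u⋖v , ≤-trans v≤N∨j (∨-least (nucleus≤ x) j≤x)
      , jJI , c , c⋖j , inj₁ (⋖⇒∨≡ u⋖v j≤v j≰u , ∧≡lowerCover jJI c⋖j c≤u j≰u))
    where
    N = nucleus x
    N∨c≤N∨j : (N ∨ c) ≤ (N ∨ j)
    N∨c≤N∨j = ∨-least (x≤x∨y N j) (≤-trans (proj₁ (proj₁ c⋖j)) (y≤x∨y N j))

  canonical-refines-∨ : ∀ {x X a b j} → IsCanonicalJoinRep x X → a ∨ b ≡ x → j ∈ X →
                        j ≤ a ⊎ j ≤ b
  canonical-refines-∨ {a = a} {b} {j} (_ , refines) refl j∈X =
    let y , y∈pair , j≤y = refines (⁅ a ⁆ ∪ ⁅ b ⁆) pair-join j j∈X in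
    [ (λ y∈a → inj₁ (subst (j ≤_) (x∈⁅y⁆⇒x≡y a y∈a) j≤y))
    , (λ y∈b → inj₂ (subst (j ≤_) (x∈⁅y⁆⇒x≡y b y∈b) j≤y)) ] (x∈p∪q⁻ _ _ y∈pair)
    where
    pair-join : JoinIs (⁅ a ⁆ ∪ ⁅ b ⁆) (a ∨ b)
    pair-join =
      (λ g g∈ → [ (λ g∈a → subst (_≤ (a ∨ b)) (sym (x∈⁅y⁆⇒x≡y a g∈a)) (x≤x∨y a b))
                , (λ g∈b → subst (_≤ (a ∨ b)) (sym (x∈⁅y⁆⇒x≡y b g∈b)) (y≤x∨y a b)) ]
                (x∈p∪q⁻ _ _ g∈)) ,
      λ z below → ∨-least (below a (x∈p∪q⁺ (inj₁ (x∈⁅x⁆ a)))) (below b (x∈p∪q⁺ (inj₂ (x∈⁅x⁆ b))))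

  bdef≡0⇒Ψ⊆Γ : ∀ {Γ} → bdef Γ ≡ 0 → ∀ x → Ψ x ⊆ Γ x
  bdef≡0⇒Ψ⊆Γ {Γ} bdef≡0 x = ∣p─q∣≡0⇒p⊆q (Ψ x) (Γ x)
    (Equivalence.to (sum-map≡0⇔ (λ x → ∣ Ψ x ─ Γ x ∣) (allFin n)) bdef≡0 (∈-allFin x))

  Ψ⊆Γ⇒bdef≡0 : ∀ {Γ} → (∀ x → Ψ x ⊆ Γ x) → bdef Γ ≡ 0
  Ψ⊆Γ⇒bdef≡0 {Γ} Ψ⊆Γ = Equivalence.from (sum-map≡0⇔ (λ x → ∣ Ψ x ─ Γ x ∣) (allFin n))
    λ {x} _ → p⊆q⇒∣p─q∣≡0 (Ψ x) (Γ x) (Ψ⊆Γ x)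

  MeetSemidistributive : Set
  MeetSemidistributive = ∀ {x y z} → x ∧ y ≡ x ∧ z → x ∧ (y ∨ z) ≡ x ∧ y

  msdl⇒meetSemidistributive : MeetSemidistributiveLattice toPos → MeetSemidistributive
  msdl⇒meetSemidistributive M {x} {y} {z} x∧y≡x∧z = antisym x∧[y∨z]≤x∧y
    (∧-greatest (x∧y≤x x y) (≤-trans (x∧y≤y x y) (x≤x∨y y z)))
    where
    module M = MeetSemidistributiveLattice M
    ⊓≡∧ : ∀ a b → a M.⊓ b ≡ a ∧ b
    ⊓≡∧ a b = antisym (∧-greatest (toWitness (M.x⊓y⊑x a b)) (toWitness (M.x⊓y⊑y a b)))
                      (toWitness (M.⊓-greatest (fromWitness (x∧y≤x a b)) (fromWitness (x∧y≤y a b))))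
    ⊔≡∨ : ∀ a b → a M.⊔ b ≡ a ∨ b
    ⊔≡∨ a b = antisym (toWitness (M.⊔-least (fromWitness (x≤x∨y a b)) (fromWitness (y≤x∨y a b))))
                      (∨-least (toWitness (M.x⊑x⊔y a b)) (toWitness (M.y⊑x⊔y a b)))
    x⊓y≡x⊓z : x M.⊓ y ≡ x M.⊓ z
    x⊓y≡x⊓z = trans (⊓≡∧ x y) (trans x∧y≡x∧z (sym (⊓≡∧ x z)))
    x∧[y∨z]≤x∧y : (x ∧ (y ∨ z)) ≤ (x ∧ y)
    x∧[y∨z]≤x∧y = subst₂ _≤_ (trans (⊓≡∧ x _) (cong (x ∧_) (⊔≡∨ y z))) (⊓≡∧ x y)
      (toWitness (M.⊓-semidistrib (fromWitness (≤-reflexive x⊓y≡x⊓z))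
                                   (fromWitness (≤-reflexive (sym x⊓y≡x⊓z)))))

  joinPrime⇒∈canonical : (∀ {j} → IsJoinIrreducible j → JoinPrime j) →
                          ∀ {x X j} → IsCanonicalJoinRep x X →
                          IsJoinIrreducible j → j ≤ x → ¬ j ≤ nucleus x → j ∈ X
  -- Pick a lower cover y of x with j ≰ y, so x = j ∨ y. Were j ∉ X, X would refine {j, y} by
  -- elements below c = j_* or y, so j ≤ x ≤ c ∨ y, against join-primality.
  joinPrime⇒∈canonical prime {x} {X} {j} canon jJI j≤x j≰N
    with ≰nucleus⇒⋖ j≤x j≰N | ji-lowerCover jJI
  ... | y , y⋖x , j≰y | c , c⋖j = decidable-stable (j ∈? X) λ j∉X →
    [ (λ j≤c → <⇒≱ (proj₁ c⋖j) j≤c) , j≰y ] (prime jJI (j≤c∨y j∉X))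
    where
    j≤c∨y : j ∉ X → j ≤ (c ∨ y)
    j≤c∨y j∉X = ≤-trans j≤x (proj₂ (proj₁ canon) (c ∨ y) λ g g∈X →
      [ (λ g≤j → ≤-trans (<ji⇒≤lowerCover jJI c⋖j (g≤j , λ { refl → j∉X g∈X })) (x≤x∨y c y))
      , (λ g≤y → ≤-trans g≤y (y≤x∨y c y)) ]
      (canonical-refines-∨ canon (⋖⇒∨≡ y⋖x j≤x j≰y) g∈X))

  joinPrime⇒Ψ⊆canonical : (∀ {j} → IsJoinIrreducible j → JoinPrime j) →
                           ∀ {x X} → IsCanonicalJoinRep x X → Ψ x ⊆ X
  joinPrime⇒Ψ⊆canonical prime canon j∈Ψ =
    let jJI , j≤x , j≰N = ∈Ψ⇒ j∈Ψ in joinPrime⇒∈canonical prime canon jJI j≤x j≰N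

  msd-lowerCover : MeetSemidistributive → ∀ {j c a b} → IsJoinIrreducible j → c ⋖ j →
                   j ≤ (a ∨ b) → j ≤ (a ∨ c) ⊎ j ≤ (b ∨ c)
  msd-lowerCover msd {j} {c} {a} {b} jJI c⋖j j≤a∨b with j ≤? (a ∨ c) | j ≤? (b ∨ c)
  ... | yes j≤a∨c | _ = inj₁ j≤a∨c
  ... | no _ | yes j≤b∨c = inj₂ j≤b∨c
  ... | no j≰a∨c | no j≰b∨c = ⊥-elim (proj₂ (proj₁ c⋖j) (sym j≡c))
    where
    meet≡c : ∀ t → ¬ j ≤ (t ∨ c) → j ∧ (t ∨ c) ≡ c
    meet≡c t = ∧≡lowerCover jJI c⋖j (y≤x∨y t c)
    j≡c : j ≡ c
    j≡c = begin
      j                             ≡⟨ sym (≤⇒∧≡ (≤-trans j≤a∨b a∨b≤)) ⟩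
      j ∧ ((a ∨ c) ∨ (b ∨ c))       ≡⟨ msd (trans (meet≡c a j≰a∨c) (sym (meet≡c b j≰b∨c))) ⟩
      j ∧ (a ∨ c)                   ≡⟨ meet≡c a j≰a∨c ⟩
      c                             ∎
      where
      open ≡-Reasoning
      a∨b≤ : (a ∨ b) ≤ ((a ∨ c) ∨ (b ∨ c))
      a∨b≤ = ∨-least (≤-trans (x≤x∨y a c) (x≤x∨y _ _)) (≤-trans (x≤x∨y b c) (y≤x∨y _ _))

  module _ (msd : MeetSemidistributive) {Γ : Fin n → Subset n}
           (canon : ∀ x → IsCanonicalJoinRep x (Γ x)) (Ψ⊆Γ : ∀ x → Ψ x ⊆ Γ x) where

    -- With c = j_*: if j ≰ x↓ ∨ c then j ∈ Ψ(x) ⊆ Γ(x). Otherwise semidistributivity puts j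
    -- below a ∨ c or b ∨ c, and c is dropped again: by induction when t ∨ c < x, and because
    -- nucleus-absorbs forces t = x when t ∨ c = x (c ≤ j ≤ x↓ by induction at x↓ ∨ c).
    joinPrime-below : ∀ {x} → Acc _<_ x → ∀ {j a b} → IsJoinIrreducible j → a ∨ b ≡ x → j ≤ x →
                      j ≤ a ⊎ j ≤ b
    joinPrime-below {x} (acc rec) {j} {a} {b} jJI a∨b≡x j≤x with ji-lowerCover jJI
    ... | c , c⋖j with j ≤? (nucleus x ∨ c)
    ...   | no j≰N∨c = canonical-refines-∨ (canon x) a∨b≡x (Ψ⊆Γ x (∈Ψ⇐ jJI c⋖j j≤x j≰N∨c))
    ...   | yes j≤N∨c =
      Data.Sum.map (drop-c (subst (a ≤_) a∨b≡x (x≤x∨y a b))) (drop-c (subst (b ≤_) a∨b≡x (y≤x∨y a b)))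
                   (msd-lowerCover msd jJI c⋖j (subst (j ≤_) (sym a∨b≡x) j≤x))
      where
      c≤j : c ≤ j
      c≤j = proj₁ (proj₁ c⋖j)
      j≰c : ¬ j ≤ c
      j≰c = <⇒≱ (proj₁ c⋖j)
      drop-c-below : ∀ {t} → t ≤ x → (t ∨ c) ≢ x → j ≤ (t ∨ c) → j ≤ t
      drop-c-below t≤x t∨c≢x j≤t∨c = [ id , ⊥-elim ∘ j≰c ]
        (joinPrime-below (rec (∨-least t≤x (≤-trans c≤j j≤x) , t∨c≢x)) jJI refl j≤t∨c)
      j≤N : j ≤ nucleus x
      j≤N = drop-c-below (nucleus≤ x)
        (λ N∨c≡x → j≰c (subst (j ≤_) (sym (nucleus-absorbs ≤-refl (trans (∨-comm c _) N∨c≡x)))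
                                     j≤x))
        j≤N∨c
      drop-c : ∀ {t} → t ≤ x → j ≤ (t ∨ c) → j ≤ t
      drop-c {t} t≤x j≤t∨c with (t ∨ c) F.≟ x
      ... | no t∨c≢x = drop-c-below t≤x t∨c≢x j≤t∨c
      ... | yes t∨c≡x = subst (j ≤_) (sym (nucleus-absorbs (≤-trans c≤j j≤N) t∨c≡x)) j≤x

    Ψ⊆canonical⇒joinPrime : ∀ {j} → IsJoinIrreducible j → JoinPrime j
    Ψ⊆canonical⇒joinPrime jJI = joinPrime-below (<-wellFounded _) jJI refl

open FinLattice using (n)
open FinLatticeDefs using (toPos; Distributive; IsCanonicalJoinRep; bdef)

proposition3p6 : (L : FinLattice) → CongUniform (toPos L) →
    (Γ : Fin (n L) → Subset (n L)) → (∀ x → IsCanonicalJoinRep L x (Γ x)) →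
    (bdef L Γ ≡ 0 ⇔ Distributive L)
proposition3p6 L cu Γ canon = mk⇔
  (λ bdef≡0 → joinPrime⇒distributive
    (Ψ⊆canonical⇒joinPrime (msdl⇒meetSemidistributive (congruenceUniform⇒msdl cu)) canon
      (bdef≡0⇒Ψ⊆Γ bdef≡0)))
  (λ distrib → Ψ⊆Γ⇒bdef≡0 λ x →
    joinPrime⇒Ψ⊆canonical (distributive⇒joinPrime distrib) (canon x))
  where open FiniteLattice L
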